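{- Let $0 < \alpha < 10^{ -6}$ and let $n, d \in \mathbb{N}$ be such that $n/150 \le d \le n/3$. Let $V, W$ be a partition of an $n$-element set with $|W| = d$, and suppose that $H$ is a $3$-uniform hypergraph on vertex set $V \cup W$ such that every vertex of $H$ is $\alpha$-good. Then $H$ contains a matching of size $d$.
   Context: $H_{n,d}(V,W)$ denotes the $3$-uniform hypergraph on vertex set $V \cup W$ whose edges are exactly the $3$-sets having two vertices in $V$ and one in $W$, or one vertex in $V$ and two in $W$. For a $3$-uniform hypergraph $G$ and a vertex $v$, the neighbourhood $N_G(v)$ is the set of unordered pairs $\{x,y\}$ such that $\{v,x,y\}$ is an edge of $G$. A vertex $v$ of $H$ is $\alpha$-good if $|N_{H_{n,d}(V,W)}(v) \setminus N_H(v)| \le \alpha n^2$. A matching of size $d$ is a set of $d$ pairwise vertex-disjoint edges. -}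

module Defs where

import Data.Nat
open import Data.Nat using (ℕ; zero; suc; _<ᵇ_; _+_)
open import Data.Bool using (Bool; true; false; _∧_; _∨_; not; if_then_else_)
import Data.Fin as Fin
open import Data.Fin using (Fin; toℕ; _≟_)
open import Data.List using (List; map; allFin)
open import Data.Nat.ListAction using (sum)
open import Data.Product using (_×_; _,_)
open import Relation.Nullary using (¬_; does)
open import Relation.Binary.PropositionalEquality using (_≡_)
open import Data.Integer using (+_)
open import Data.Rational using (ℚ; _/_; _*_; _≤_)

countᵇ : {n : ℕ} → (Fin n → Bool) → ℕ
countᵇ {n} p = sum (map (λ i → if p i then 1 else 0) (allFin n))

ℕ→ℚ : ℕ → ℚ
ℕ→ℚ k = (+ k) / 1

distinctᵇ : {n : ℕ} → Fin n → Fin n → Fin n → Bool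
distinctᵇ x y z = not (does (x ≟ y)) ∧ not (does (y ≟ z)) ∧ not (does (x ≟ z))

-- A 3-uniform hypergraph on vertex set Fin n: an edge indicator on triples,
-- invariant under permutations, and vanishing on non-distinct triples
-- (so its edges are exactly 3-element subsets of Fin n).
record Hypergraph3 (n : ℕ) : Set where
  field
    edge    : Fin n → Fin n → Fin n → Bool
    sym₁₂   : ∀ x y z → edge x y z ≡ edge y x z
    sym₂₃   : ∀ x y z → edge x y z ≡ edge x z y
    uniform : ∀ x y z → edge x y z ≡ true → distinctᵇ x y z ≡ true
open Hypergraph3 public

-- H_{n,d}(V,W) where W = { w | inW w ≡ true } and V is its complement:
-- edges are 3-sets with exactly one or exactly two vertices in W.
Hnd-edge : {n : ℕ} → (Fin n → Bool) → Fin n → Fin n → Fin n → Bool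
Hnd-edge inW x y z =
  distinctᵇ x y z ∧ (k ≡ᵇ 1 ∨ k ≡ᵇ 2)
  where
    b : Bool → ℕ
    b true = 1
    b false = 0
    k : ℕ
    k = b (inW x) + b (inW y) + b (inW z)
    _≡ᵇ_ : ℕ → ℕ → Bool
    zero ≡ᵇ zero = true
    suc a ≡ᵇ suc c = a ≡ᵇ c
    _ ≡ᵇ _ = false

-- |N_{H_{n,d}(V,W)}(v) \ N_H(v)| : the number of unordered pairs {x,y}
-- (counted as x < y) with {v,x,y} an edge of H_{n,d}(V,W) but not of H.
missing : {n : ℕ} → (Fin n → Bool) → Hypergraph3 n → Fin n → ℕ
missing inW H v =
  sum (map (λ x → countᵇ (λ y →
         (toℕ x <ᵇ toℕ y) ∧ Hnd-edge inW v x y ∧ not (edge H v x y)))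
       (allFin _))

good : {n : ℕ} → ℚ → (Fin n → Bool) → Hypergraph3 n → Fin n → Set
good {n} α inW H v = ℕ→ℚ (missing inW H v) ≤ α * ℕ→ℚ (n Data.Nat.* n)

-- a matching of size d in H: d edges (rows of M) which are pairwise
-- vertex-disjoint (M injective on Fin d × Fin 3 covers both
-- distinctness inside an edge and disjointness between edges).
record Matching {n : ℕ} (H : Hypergraph3 n) (d : ℕ) : Set where
  field
    M        : Fin d → Fin 3 → Fin n
    isEdge   : ∀ i → edge H (M i Fin.zero) (M i (Fin.suc Fin.zero)) (M i (Fin.suc (Fin.suc Fin.zero))) ≡ true
    disjoint : ∀ i j a b → M i a ≡ M j b → (i ≡ j) × (a ≡ b)

-- The proof is a switching argument.  A *transversal* is a family of d pairwise disjoint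
-- triples, row r holding a W-vertex wᵣ in slot 0 and V-vertices v¹ᵣ, v²ᵣ in slots 1, 2;
-- since |W| = d and |V| ≥ 2d one exists.  Suppose row i is not an edge of H.  For rows
-- j, k the *switch* lets each two of the rows i, j, k exchange one V-vertex, producing
-- {wᵢ, v¹ⱼ, v¹ₖ}, {wⱼ, v¹ᵢ, v²ₖ} and {wₖ, v²ᵢ, v²ⱼ}.  A pair (j , k) is bad if it is
-- degenerate (at most 3d pairs) or one of these triples is a non-edge of H; such a
-- non-edge is a missing neighbour pair of wᵢ, v¹ᵢ or v²ᵢ, chosen injectively, so at most
-- 2(m₀ + m₁ + m₂) pairs are bad, where m_s ≤ n²/10⁶ by α-goodness and m₀ ≥ 1 since row
-- i itself is missing.  As n ≤ 150d this is below d², so a good pair exists, and the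
-- switch makes row i an edge while all three new rows are edges.  Repairing the rows one
-- after another turns the initial transversal into a matching.
module Submission where

module SwitchingArgument where

  open import Defs
  open import Data.Nat using (ℕ; zero; suc; _+_; _*_; _≤_; _<_; z≤n; s≤s; _<ᵇ_; >-nonZero)
  import Data.Nat.Properties as ℕP
  open import Data.Nat.ListAction using (sum)
  open import Data.Nat.Tactic.RingSolver using (solve-∀)
  import Data.Nat.Coprimality as Coprime
  open import Data.Bool using (Bool; true; false; _∧_; _∨_; not; if_then_else_; T)
  import Data.Bool.Properties as BoolP
  open import Data.Fin using (Fin; toℕ; _≟_)
  import Data.Fin as Fin
  import Data.Fin.Properties as FinP
  import Data.Integer as ℤ
  import Data.Integer.Properties as ℤP
  import Data.Rational as ℚ
  import Data.Rational.Properties as ℚP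
  import Data.Rational.Unnormalised.Properties as ℚᵘP
  open import Data.List using (List; []; _∷_; map; _++_; length; cartesianProduct; allFin; lookup)
  import Data.List.Properties as ListP
  open import Data.List.Membership.Propositional using (_∈_)
  open import Data.List.Membership.Propositional.Properties using (∈-∃++; ∈-++⁺ˡ; ∈-++⁺ʳ; ∈-++⁻; ∈-allFin; ∈-cartesianProduct⁺; ∈-lookup)
  open import Data.List.Relation.Unary.Any using (here; there)
  import Data.List.Relation.Unary.All as All
  open import Data.List.Relation.Unary.AllPairs using ([]; _∷_)
  open import Data.List.Relation.Unary.Unique.Propositional using (Unique)
  import Data.List.Relation.Unary.Unique.Propositional.Properties as UniqueP
  open import Data.Maybe using (Maybe; just; nothing)
  open import Data.Product using (Σ; _×_; _,_; proj₁; proj₂)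
  open import Data.Sum using (inj₁; inj₂)
  open import Data.Empty using (⊥-elim)
  open import Function using (id)
  open import Relation.Nullary using (yes; no; does)
  open import Relation.Nullary.Decidable using (dec-true; dec-false)
  open import Relation.Binary.Definitions using (tri<; tri≈; tri>)
  open import Relation.Binary.PropositionalEquality

  pattern 0F = Fin.zero
  pattern 1F = Fin.suc Fin.zero
  pattern 2F = Fin.suc (Fin.suc Fin.zero)

  ∧-true : ∀ {a b} → (a ∧ b) ≡ true → a ≡ true × b ≡ true
  ∧-true {true} b≡true = refl , b≡true

  ∨-false : ∀ {a b} → (a ∨ b) ≡ false → a ≡ false × b ≡ false
  ∨-false {false} b≡false = refl , b≡false

  not-true : ∀ {a} → not a ≡ true → a ≡ false
  not-true {false} _ = refl

  not-false : ∀ {a} → not a ≡ false → a ≡ true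
  not-false {true} _ = refl

  cong₃ : ∀ {A B C D : Set} (f : A → B → C → D) {a a' b b' c c'} →
    a ≡ a' → b ≡ b' → c ≡ c' → f a b c ≡ f a' b' c'
  cong₃ f refl refl refl = refl

  _==_ : ∀ {m} → Fin m → Fin m → Bool
  a == b = does (a ≟ b)

  ==-sound : ∀ {m} (a b : Fin m) → (a == b) ≡ true → a ≡ b
  ==-sound a b eq with a ≟ b
  ... | yes a≡b = a≡b
  ==-sound a b () | no _

  ==-false : ∀ {m} (a b : Fin m) → (a == b) ≡ false → a ≢ b
  ==-false a b eq with a ≟ b
  ... | no a≢b = a≢b
  ==-false a b () | yes _

  module _ {A : Set} where

    count : (A → Bool) → List A → ℕ
    count p xs = sum (map (λ x → if p x then 1 else 0) xs)

    InjectiveOn : {B : Set} → (A → Bool) → (A → B) → Set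
    InjectiveOn p f = ∀ a b → p a ≡ true → p b ≡ true → f a ≡ f b → a ≡ b

    count-++ : ∀ (p : A → Bool) xs ys → count p (xs ++ ys) ≡ count p xs + count p ys
    count-++ p []       ys = refl
    count-++ p (x ∷ xs) ys =
      trans (cong ((if p x then 1 else 0) +_) (count-++ p xs ys)) (sym (ℕP.+-assoc (if p x then 1 else 0) _ _))

    count-const-true : ∀ xs → count (λ _ → true) xs ≡ length xs
    count-const-true []       = refl
    count-const-true (x ∷ xs) = cong suc (count-const-true xs)

    count-split : ∀ (p q : A → Bool) xs →
      count p xs ≡ count (λ x → p x ∧ q x) xs + count (λ x → p x ∧ not (q x)) xs
    count-split p q [] = refl
    count-split p q (x ∷ xs) with p x | q x
    ... | false | _     = count-split p q xs
    ... | true  | true  = cong suc (count-split p q xs)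
    ... | true  | false = trans (cong suc (count-split p q xs)) (sym (ℕP.+-suc _ _))

    count-∨ : ∀ (p q : A → Bool) xs → count (λ x → p x ∨ q x) xs ≤ count p xs + count q xs
    count-∨ p q [] = z≤n
    count-∨ p q (x ∷ xs) with p x | q x
    ... | false | false = count-∨ p q xs
    ... | false | true  = ℕP.≤-trans (s≤s (count-∨ p q xs)) (ℕP.≤-reflexive (sym (ℕP.+-suc _ _)))
    ... | true  | false = s≤s (count-∨ p q xs)
    ... | true  | true  = s≤s (ℕP.≤-trans (count-∨ p q xs)
                                (ℕP.≤-trans (ℕP.n≤1+n _) (ℕP.≤-reflexive (sym (ℕP.+-suc _ _)))))

    count-pos : ∀ (p : A → Bool) {x} xs → x ∈ xs → p x ≡ true → 1 ≤ count p xs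
    count-pos p (y ∷ xs) (here refl) px rewrite px = s≤s z≤n
    count-pos p (y ∷ xs) (there x∈xs) px with p y
    ... | true  = s≤s z≤n
    ... | false = count-pos p xs x∈xs px

    count<length⇒witness : ∀ (p : A → Bool) xs → count p xs < length xs → Σ A λ x → x ∈ xs × p x ≡ false
    count<length⇒witness p (x ∷ xs) lt with p x in px
    ... | false = x , here refl , px
    ... | true with count<length⇒witness p xs (ℕP.≤-pred lt)
    ...   | y , y∈xs , py = y , there y∈xs , py

    unique-length≤count : ∀ (q : A → Bool) (zs ys : List A) → Unique zs →
      (∀ z → z ∈ zs → z ∈ ys × q z ≡ true) → length zs ≤ count q ys
    unique-length≤count q []       ys _ _ = z≤n
    unique-length≤count q (z ∷ zs) ys (z∉zs ∷ uniq) inside with inside z (here refl)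
    ... | z∈ys , qz with ∈-∃++ z∈ys
    ...   | ys₁ , ys₂ , refl = ℕP.≤-trans (s≤s ih) (ℕP.≤-reflexive removed)
      where
      inside' : ∀ w → w ∈ zs → w ∈ ys₁ ++ ys₂ × q w ≡ true
      inside' w w∈zs with inside w (there w∈zs)
      ... | w∈ys , qw with ∈-++⁻ ys₁ w∈ys
      ...   | inj₁ w∈ys₁         = ∈-++⁺ˡ w∈ys₁ , qw
      ...   | inj₂ (here refl)   = ⊥-elim (All.lookup z∉zs w∈zs refl)
      ...   | inj₂ (there w∈ys₂) = ∈-++⁺ʳ ys₁ w∈ys₂ , qw
      ih : length zs ≤ count q (ys₁ ++ ys₂)
      ih = unique-length≤count q zs (ys₁ ++ ys₂) uniq inside'
      removed : suc (count q (ys₁ ++ ys₂)) ≡ count q (ys₁ ++ z ∷ ys₂)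
      removed rewrite count-++ q ys₁ ys₂ | count-++ q ys₁ (z ∷ ys₂) | qz = sym (ℕP.+-suc _ _)

  module _ {A B : Set} where

    count-map : ∀ (p : B → Bool) (f : A → B) xs → count p (map f xs) ≡ count (λ x → p (f x)) xs
    count-map p f []       = refl
    count-map p f (x ∷ xs) = cong ((if p (f x) then 1 else 0) +_) (count-map p f xs)

    mapFilter : (A → Bool) → (A → B) → List A → List B
    mapFilter p f []       = []
    mapFilter p f (x ∷ xs) = if p x then f x ∷ mapFilter p f xs else mapFilter p f xs

    length-mapFilter : ∀ (p : A → Bool) (f : A → B) xs → length (mapFilter p f xs) ≡ count p xs
    length-mapFilter p f [] = refl
    length-mapFilter p f (x ∷ xs) with p x
    ... | true  = cong suc (length-mapFilter p f xs)
    ... | false = length-mapFilter p f xs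

    ∈-mapFilter : ∀ (p : A → Bool) (f : A → B) xs {z} → z ∈ mapFilter p f xs →
      Σ A λ x → x ∈ xs × p x ≡ true × f x ≡ z
    ∈-mapFilter p f (x ∷ xs) z∈ with p x in px
    ∈-mapFilter p f (x ∷ xs) (here refl) | true = x , here refl , px , refl
    ∈-mapFilter p f (x ∷ xs) (there z∈)  | true with ∈-mapFilter p f xs z∈
    ... | y , y∈ , py , fy = y , there y∈ , py , fy
    ∈-mapFilter p f (x ∷ xs) z∈ | false with ∈-mapFilter p f xs z∈
    ... | y , y∈ , py , fy = y , there y∈ , py , fy

    unique-mapFilter : ∀ (p : A → Bool) (f : A → B) xs → Unique xs → InjectiveOn p f → Unique (mapFilter p f xs)
    unique-mapFilter p f []       _ _ = []
    unique-mapFilter p f (x ∷ xs) (x∉xs ∷ uniq) inj with p x in px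
    ... | false = unique-mapFilter p f xs uniq inj
    ... | true  = All.tabulate fresh ∷ unique-mapFilter p f xs uniq inj
      where
      fresh : ∀ {z} → z ∈ mapFilter p f xs → f x ≢ z
      fresh z∈ fx≡z with ∈-mapFilter p f xs z∈
      ... | y , y∈xs , py , refl = All.lookup x∉xs y∈xs (inj x y px py fx≡z)

    count-injection : ∀ (p : A → Bool) (q : B → Bool) (f : A → B) xs ys → Unique xs →
      (∀ x → x ∈ xs → p x ≡ true → f x ∈ ys × q (f x) ≡ true) → InjectiveOn p f →
      count p xs ≤ count q ys
    count-injection p q f xs ys uniq maps inj =
      subst (_≤ count q ys) (length-mapFilter p f xs)
        (unique-length≤count q (mapFilter p f xs) ys (unique-mapFilter p f xs uniq inj) inside)
      where
      inside : ∀ z → z ∈ mapFilter p f xs → z ∈ ys × q z ≡ true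
      inside z z∈ with ∈-mapFilter p f xs z∈
      ... | x , x∈ , px , refl = maps x x∈ px

  module _ {A B : Set} where

    count-cartesianProduct : ∀ (φ : A → B → Bool) xs ys →
      sum (map (λ x → count (φ x) ys) xs) ≡ count (λ ab → φ (proj₁ ab) (proj₂ ab)) (cartesianProduct xs ys)
    count-cartesianProduct φ []       ys = refl
    count-cartesianProduct φ (x ∷ xs) ys =
      trans (cong₂ _+_ (sym (count-map _ (x ,_) ys)) (count-cartesianProduct φ xs ys))
            (sym (count-++ _ (map (x ,_) ys) _))

  pairs : (m : ℕ) → List (Fin m × Fin m)
  pairs m = cartesianProduct (allFin m) (allFin m)

  unique-pairs : ∀ m → Unique (pairs m)
  unique-pairs m = UniqueP.cartesianProduct⁺ (UniqueP.allFin⁺ m) (UniqueP.allFin⁺ m)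

  ∈-pairs : ∀ {m} (a : Fin m × Fin m) → a ∈ pairs m
  ∈-pairs (x , y) = ∈-cartesianProduct⁺ (∈-allFin x) (∈-allFin y)

  length-cartesianProduct : ∀ {A B : Set} (xs : List A) (ys : List B) →
    length (cartesianProduct xs ys) ≡ length xs * length ys
  length-cartesianProduct []       ys = refl
  length-cartesianProduct (x ∷ xs) ys =
    trans (ListP.length-++ (map (x ,_) ys))
          (cong₂ _+_ (ListP.length-map (x ,_) ys) (length-cartesianProduct xs ys))

  length-allFin : ∀ m → length (allFin m) ≡ m
  length-allFin m = ListP.length-tabulate {n = m} id

  length-pairs : ∀ m → length (pairs m) ≡ m * m
  length-pairs m = trans (length-cartesianProduct (allFin m) (allFin m)) (cong₂ _*_ (length-allFin m) (length-allFin m))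

  count≤size : ∀ {A : Set} {m} (p : A → Bool) (f : A → Fin m) xs → Unique xs → InjectiveOn p f → count p xs ≤ m
  count≤size {m = m} p f xs uniq inj =
    subst (count p xs ≤_) (trans (count-const-true (allFin m)) (length-allFin m))
      (count-injection p (λ _ → true) f xs (allFin m) uniq (λ x _ _ → ∈-allFin (f x) , refl) inj)

  <ᵇ-flip : ∀ {m} (x y : Fin m) → x ≢ y → (toℕ x <ᵇ toℕ y) ≡ false → (toℕ y <ᵇ toℕ x) ≡ true
  <ᵇ-flip x y x≢y x≮y with ℕP.<-cmp (toℕ x) (toℕ y)
  ... | tri< x<y _ _ = ⊥-elim (subst T x≮y (ℕP.<⇒<ᵇ x<y))
  ... | tri≈ _ x≡y _ = ⊥-elim (x≢y (FinP.toℕ-injective x≡y))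
  ... | tri> _ _ y<x = T-true (ℕP.<⇒<ᵇ y<x)
    where
    T-true : ∀ {b} → T b → b ≡ true
    T-true {true} _ = refl

  lookup-injective : ∀ {A : Set} (xs : List A) → Unique xs → ∀ a b → lookup xs a ≡ lookup xs b → a ≡ b
  lookup-injective (x ∷ xs) _            Fin.zero    Fin.zero    _ = refl
  lookup-injective (x ∷ xs) (x∉xs ∷ _)   Fin.zero    (Fin.suc b) e = ⊥-elim (All.lookup x∉xs (∈-lookup b) e)
  lookup-injective (x ∷ xs) (x∉xs ∷ _)   (Fin.suc a) Fin.zero    e = ⊥-elim (All.lookup x∉xs (∈-lookup a) (sym e))
  lookup-injective (x ∷ xs) (_ ∷ uniq)   (Fin.suc a) (Fin.suc b) e = cong Fin.suc (lookup-injective xs uniq a b e)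

  entry : ∀ {A : Set} {m} (xs : List A) → m ≤ length xs → Fin m → A
  entry xs m≤ a = lookup xs (Fin.inject≤ a m≤)

  entry-injective : ∀ {A : Set} {m} (xs : List A) (m≤ : m ≤ length xs) → Unique xs →
    ∀ a b → entry xs m≤ a ≡ entry xs m≤ b → a ≡ b
  entry-injective xs m≤ uniq a b e = FinP.inject≤-injective m≤ m≤ a b (lookup-injective xs uniq _ _ e)

  square-bound : ∀ n d → n ≤ 150 * d → n * n ≤ 22500 * (d * d)
  square-bound n d n≤150d = ℕP.≤-trans (ℕP.*-mono-≤ n≤150d n≤150d) (ℕP.≤-reflexive (regroup 150 d))
    where
    regroup : ∀ a d → (a * d) * (a * d) ≡ (a * a) * (d * d)
    regroup = solve-∀

  small-square : ∀ n d → n ≤ 150 * d → d ≤ 3 → n * n ≤ 202500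
  small-square n d n≤150d d≤3 =
    ℕP.≤-trans (square-bound n d n≤150d) (ℕP.*-monoʳ-≤ 22500 (ℕP.*-mono-≤ d≤3 d≤3))

  -- a positive m with 10⁶·m ≤ n² forces n² ≥ 10⁶, which needs d ≥ 4 when n ≤ 150d
  four≤d : ∀ n d m → n ≤ 150 * d → m * 1000000 ≤ n * n → 1 ≤ m → 4 ≤ d
  four≤d n d m n≤150d bound 1≤m = ℕP.≰⇒> λ d≤3 → ℕP.≤⇒≤ᵇ (million≤ d≤3)
    where
    million≤ : d ≤ 3 → 1000000 ≤ 202500
    million≤ d≤3 = ℕP.≤-trans (ℕP.≤-trans (ℕP.m≤n*m 1000000 m {{>-nonZero 1≤m}}) bound)
                               (small-square n d n≤150d d≤3)

  -- If each m_s ≤ n²/10⁶ (and m₀ ≥ 1), then 3d + 2(m₀ + m₁ + m₂) < d²: as n ≤ 150d,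
  -- 10⁶ times the left side is at most 3·10⁶·d + 135000·d², below 10⁶·d² once d ≥ 4.
  fewer-than-d² : ∀ n d m₀ m₁ m₂ → n ≤ 150 * d →
    m₀ * 1000000 ≤ n * n → m₁ * 1000000 ≤ n * n → m₂ * 1000000 ≤ n * n → 1 ≤ m₀ →
    d + (d + d) + ((m₀ + m₀) + ((m₁ + m₁) + (m₂ + m₂))) < d * d
  fewer-than-d² n d m₀ m₁ m₂ n≤150d b₀ b₁ b₂ 1≤m₀ = ℕP.*-cancelˡ-< 1000000 _ _ scaled
    where
    open ℕP.≤-Reasoning
    4≤d : 4 ≤ d
    4≤d = four≤d n d m₀ n≤150d b₀ 1≤m₀
    expand : ∀ c d m₀ m₁ m₂ → c * (d + (d + d) + ((m₀ + m₀) + ((m₁ + m₁) + (m₂ + m₂))))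
           ≡ (3 * c) * d + (2 * (m₀ * c) + (2 * (m₁ * c) + 2 * (m₂ * c)))
    expand = solve-∀
    six-n² : ∀ N → 2 * N + (2 * N + 2 * N) ≡ 6 * N
    six-n² = solve-∀
    linear : ∀ c D → 6 * (c * D) ≡ (6 * c) * D
    linear = solve-∀
    regroup : ∀ c d → (4 * c) * d ≡ c * (4 * d)
    regroup = solve-∀
    collect : ∀ a b X → a * X + b * X ≡ (a + b) * X
    collect = solve-∀
    missing-part : 2 * (m₀ * 1000000) + (2 * (m₁ * 1000000) + 2 * (m₂ * 1000000)) ≤ 135000 * (d * d)
    missing-part = begin
      2 * (m₀ * 1000000) + (2 * (m₁ * 1000000) + 2 * (m₂ * 1000000))
        ≤⟨ ℕP.+-mono-≤ (ℕP.*-monoʳ-≤ 2 b₀) (ℕP.+-mono-≤ (ℕP.*-monoʳ-≤ 2 b₁) (ℕP.*-monoʳ-≤ 2 b₂)) ⟩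
      2 * (n * n) + (2 * (n * n) + 2 * (n * n)) ≡⟨ six-n² (n * n) ⟩
      6 * (n * n)                               ≤⟨ ℕP.*-monoʳ-≤ 6 (square-bound n d n≤150d) ⟩
      6 * (22500 * (d * d))                     ≡⟨ linear 22500 (d * d) ⟩
      135000 * (d * d)                          ∎
    degenerate-part : 3000000 * d < 865000 * (d * d)
    degenerate-part = begin-strict
      3000000 * d      <⟨ ℕP.*-monoˡ-< d {{>-nonZero (ℕP.≤-trans (s≤s z≤n) 4≤d)}} (ℕP.≤ᵇ⇒≤ 3000001 3460000 _) ⟩
      3460000 * d      ≡⟨ regroup 865000 d ⟩
      865000 * (4 * d) ≤⟨ ℕP.*-monoʳ-≤ 865000 (ℕP.*-monoˡ-≤ d 4≤d) ⟩
      865000 * (d * d) ∎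
    scaled : 1000000 * (d + (d + d) + ((m₀ + m₀) + ((m₁ + m₁) + (m₂ + m₂)))) < 1000000 * (d * d)
    scaled = begin-strict
      1000000 * (d + (d + d) + ((m₀ + m₀) + ((m₁ + m₁) + (m₂ + m₂))))
        ≡⟨ expand 1000000 d m₀ m₁ m₂ ⟩
      3000000 * d + (2 * (m₀ * 1000000) + (2 * (m₁ * 1000000) + 2 * (m₂ * 1000000)))
        ≤⟨ ℕP.+-monoʳ-≤ (3000000 * d) missing-part ⟩
      3000000 * d + 135000 * (d * d)     <⟨ ℕP.+-monoˡ-< (135000 * (d * d)) degenerate-part ⟩
      865000 * (d * d) + 135000 * (d * d) ≡⟨ collect 865000 135000 (d * d) ⟩
      1000000 * (d * d)                  ∎

  ℕ→ℚ-normal : ∀ k → ℕ→ℚ k ≡ ℚ.mkℚ (ℤ.+ k) 0 (Coprime.sym (Coprime.1-coprimeTo k))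
  ℕ→ℚ-normal k = ℚP.normalize-coprime (Coprime.sym (Coprime.1-coprimeTo k))

  reciprocal-normal : ∀ c → (ℤ.+ 1) ℚ./ suc c ≡ ℚ.mkℚ (ℤ.+ 1) c (Coprime.1-coprimeTo (suc c))
  reciprocal-normal c = ℚP.normalize-coprime (Coprime.1-coprimeTo (suc c))

  -- for 0 < α < 1/(c+1), an inequality m ≤ α·N between naturals gives m·(c+1) ≤ N.
  -- (Bounds are kept in the form m·10⁶ rather than 10⁶·m: ℕ-multiplication recurses on its
  -- left argument, and a literal there would unfold a million times under normalisation.)
  scaled-bound : ∀ c (α : ℚ.ℚ) → ℚ.0ℚ ℚ.< α → α ℚ.< (ℤ.+ 1) ℚ./ suc c →
    (m N : ℕ) → ℕ→ℚ m ℚ.≤ α ℚ.* ℕ→ℚ N → m * suc c ≤ N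
  -- a negative numerator contradicts 0 < α
  scaled-bound c (ℚ.mkℚ ℤ.-[1+ p ] q _) 0<α _ _ _ _ with ℚP.drop-*<* 0<α
  ... | lt rewrite ℤP.*-identityʳ ℤ.-[1+ p ] with lt
  ... | ()
  scaled-bound c α@(ℚ.mkℚ (ℤ.+ p) q _) _ α<1/c m N m≤αN =
    ℕP.*-cancelʳ-≤ (m * suc c) N (suc q) (begin
      m * suc c * suc q   ≡⟨ regroup m (suc c) (suc q) ⟩
      suc c * (m * suc q) ≤⟨ ℕP.*-monoʳ-≤ (suc c) m·q≤p·N ⟩
      suc c * (p * N)     ≡⟨ regroup′ (suc c) p N ⟩
      p * suc c * N       ≤⟨ ℕP.*-monoˡ-≤ N p·c≤q ⟩
      suc q * N           ≡⟨ ℕP.*-comm (suc q) N ⟩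
      N * suc q           ∎)
    where
    open ℕP.≤-Reasoning
    regroup : ∀ a b c → a * b * c ≡ b * (a * c)
    regroup = solve-∀
    regroup′ : ∀ a b c → a * (b * c) ≡ b * a * c
    regroup′ = solve-∀
    -- m ≤ (p / (q+1))·N, cleared of denominators: pass to unnormalised rationals, where the
    -- product is computed componentwise, and read the inequality off in ℤ and then in ℕ
    m·q≤p·N : m * suc q ≤ p * N
    m·q≤p·N = subst₂ _≤_ (cong (λ z → m * suc z) (ℕP.*-identityʳ q)) (ℕP.*-identityʳ (p * N))
      (ℤP.drop‿+≤+ (subst₂ ℤ._≤_ (sym (ℤP.pos-* m _))
                                 (trans (cong (ℤ._* ℤ.+ 1) (ℤP.+◃n≡+n (p * N))) (sym (ℤP.pos-* (p * N) 1)))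
        (ℚᵘP.drop-*≤* (ℚᵘP.≤-respʳ-≃ (ℚP.toℚᵘ-homo-* α (ℚ.mkℚ (ℤ.+ N) 0 (Coprime.sym (Coprime.1-coprimeTo N))))
          (ℚP.toℚᵘ-mono-≤ (subst₂ ℚ._≤_ (ℕ→ℚ-normal m) (cong (α ℚ.*_) (ℕ→ℚ-normal N)) m≤αN))))))
    -- p / (q+1) < 1 / (c+1), cleared of denominators
    p·c≤q : p * suc c ≤ suc q
    p·c≤q = ℕP.<⇒≤ (subst (p * suc c <_) (ℕP.*-identityˡ (suc q))
      (ℤP.drop‿+<+ (subst₂ ℤ._<_ (sym (ℤP.pos-* p _)) (sym (ℤP.pos-* 1 _))
        (ℚP.drop-*<* (subst (α ℚ.<_) (reciprocal-normal c) α<1/c)))))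

  distinctᵇ-intro : ∀ {n} {x y z : Fin n} → x ≢ y → y ≢ z → x ≢ z → distinctᵇ x y z ≡ true
  distinctᵇ-intro {x = x} {y} {z} x≢y y≢z x≢z
    rewrite dec-false (x ≟ y) x≢y | dec-false (y ≟ z) y≢z | dec-false (x ≟ z) x≢z = refl

  mixed : Bool → Bool → Bool → Bool
  mixed a b c = (a ∨ (b ∨ c)) ∧ not (a ∧ (b ∧ c))

  mixed-swap : ∀ a b c → mixed a b c ≡ mixed a c b
  mixed-swap a b c = cong₂ (λ u w → (a ∨ u) ∧ not (a ∧ w)) (BoolP.∨-comm b c) (BoolP.∧-comm b c)

  Hnd-edge-intro : ∀ {n} (inW : Fin n → Bool) {v x y : Fin n} → v ≢ x → x ≢ y → v ≢ y →
    mixed (inW v) (inW x) (inW y) ≡ true → Hnd-edge inW v x y ≡ true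
  Hnd-edge-intro inW {v} {x} {y} v≢x x≢y v≢y mix rewrite distinctᵇ-intro v≢x x≢y v≢y
    with inW v | inW x | inW y
  ... | false | false | false = mix
  ... | false | false | true  = refl
  ... | false | true  | false = refl
  ... | false | true  | true  = refl
  ... | true  | false | false = refl
  ... | true  | false | true  = refl
  ... | true  | true  | false = refl
  ... | true  | true  | true  = mix

  isW : Fin 3 → Bool
  isW 0F          = true
  isW (Fin.suc _) = false

  module Switching (n d : ℕ) (inW : Fin n → Bool) (H : Hypergraph3 n) where

    missingPair : Fin n → Fin n × Fin n → Bool
    missingPair v (x , y) = (toℕ x <ᵇ toℕ y) ∧ Hnd-edge inW v x y ∧ not (edge H v x y)

    missing≡count : ∀ v → missing inW H v ≡ count (missingPair v) (pairs n)
    missing≡count v = count-cartesianProduct (λ x y → missingPair v (x , y)) (allFin n) (allFin n)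

    record MissingTriple (v x y : Fin n) : Set where
      field
        x≢y      : x ≢ y
        edgeᴴⁿᵈ  : Hnd-edge inW v x y ≡ true
        edgeᴴⁿᵈ′ : Hnd-edge inW v y x ≡ true
        non-edge : edge H v x y ≡ false

    missingTriple : ∀ {v x y} → v ≢ x → x ≢ y → v ≢ y →
      mixed (inW v) (inW x) (inW y) ≡ true → edge H v x y ≡ false → MissingTriple v x y
    missingTriple {v} {x} {y} v≢x x≢y v≢y mix non-edge = record
      { x≢y      = x≢y
      ; edgeᴴⁿᵈ  = Hnd-edge-intro inW v≢x x≢y v≢y mix
      ; edgeᴴⁿᵈ′ = Hnd-edge-intro inW v≢y (≢-sym x≢y) v≢x (trans (sym (mixed-swap (inW v) (inW x) (inW y))) mix)
      ; non-edge = non-edge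
      }

    missingPair-increasing : ∀ {v x y} → MissingTriple v x y → (toℕ x <ᵇ toℕ y) ≡ true → missingPair v (x , y) ≡ true
    missingPair-increasing t x<y rewrite x<y | MissingTriple.edgeᴴⁿᵈ t | MissingTriple.non-edge t = refl

    missingPair-decreasing : ∀ {v x y} → MissingTriple v x y → (toℕ x <ᵇ toℕ y) ≡ false → missingPair v (y , x) ≡ true
    missingPair-decreasing {v} {x} {y} t x≮y
      rewrite <ᵇ-flip x y (MissingTriple.x≢y t) x≮y | MissingTriple.edgeᴴⁿᵈ′ t
            | H .sym₂₃ v y x | MissingTriple.non-edge t = refl

    missing-pos : ∀ {v x y} → MissingTriple v x y → 1 ≤ missing inW H v
    missing-pos {v} {x} {y} t = subst (1 ≤_) (sym (missing≡count v)) (by-order (toℕ x <ᵇ toℕ y) refl)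
      where
      by-order : ∀ b → (toℕ x <ᵇ toℕ y) ≡ b → 1 ≤ count (missingPair v) (pairs n)
      by-order true  x<y = count-pos (missingPair v) (pairs n) (∈-pairs (x , y)) (missingPair-increasing t x<y)
      by-order false x≮y = count-pos (missingPair v) (pairs n) (∈-pairs (y , x)) (missingPair-decreasing t x≮y)

    -- a family of objects a, assigned injectively to missing triples {v} ∪ f a, has at most
    -- 2·missing v members: each missing pair arises from at most the two orders of f a
    count≤twice-missing : ∀ {A : Set} v (P : A → Bool) (f : A → Fin n × Fin n) xs → Unique xs → InjectiveOn P f →
      (∀ a → P a ≡ true → MissingTriple v (proj₁ (f a)) (proj₂ (f a))) → count P xs ≤ missing inW H v + missing inW H v
    count≤twice-missing {A} v P f xs uniq inj triple =
      subst (λ k → count P xs ≤ k + k) (sym (missing≡count v))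
        (ℕP.≤-trans (ℕP.≤-reflexive (count-split P increasing xs)) (ℕP.+-mono-≤ in-order reversed))
      where
      increasing : A → Bool
      increasing a = toℕ (proj₁ (f a)) <ᵇ toℕ (proj₂ (f a))
      swap : Fin n × Fin n → Fin n × Fin n
      swap (x , y) = y , x
      in-order : count (λ a → P a ∧ increasing a) xs ≤ count (missingPair v) (pairs n)
      in-order = count-injection _ (missingPair v) f xs (pairs n) uniq
        (λ a _ Pa∧inc → let (Pa , inc) = ∧-true Pa∧inc in
           ∈-pairs (f a) , missingPair-increasing (triple a Pa) inc)
        (λ a b Pa Pb → inj a b (proj₁ (∧-true Pa)) (proj₁ (∧-true Pb)))
      reversed : count (λ a → P a ∧ not (increasing a)) xs ≤ count (missingPair v) (pairs n)
      reversed = count-injection _ (missingPair v) (λ a → swap (f a)) xs (pairs n) uniq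
        (λ a _ Pa∧dec → let (Pa , dec) = ∧-true Pa∧dec in
           ∈-pairs (swap (f a)) , missingPair-decreasing (triple a Pa) (not-true dec))
        (λ a b Pa Pb e → inj a b (proj₁ (∧-true Pa)) (proj₁ (∧-true Pb)) (cong swap e))

    -- d pairwise disjoint triples, row r having its W-vertex in slot 0 and its V-vertices in
    -- slots 1, 2; the rows need not be edges of H
    record Transversal : Set where
      field
        vertex   : Fin d → Fin 3 → Fin n
        disjoint : ∀ r r' s s' → vertex r s ≡ vertex r' s' → (r ≡ r') × (s ≡ s')
        colour   : ∀ r s → inW (vertex r s) ≡ isW s

    rowEdge : Transversal → Fin d → Bool
    rowEdge T r = edge H (vertex r 0F) (vertex r 1F) (vertex r 2F)
      where open Transversal T

    reslot : (T : Transversal) (σ : Fin d × Fin 3 → Fin d × Fin 3) → (∀ x → σ (σ x) ≡ x) →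
      (∀ x → isW (proj₂ (σ x)) ≡ isW (proj₂ x)) → Transversal
    reslot T σ involutive preserves = record
      { vertex   = vertex′
      ; disjoint = λ r r' s s' e → let same = injective (r , s) (r' , s') e in cong proj₁ same , cong proj₂ same
      ; colour   = λ r s → trans (colour (proj₁ (σ (r , s))) (proj₂ (σ (r , s)))) (preserves (r , s))
      }
      where
      open Transversal T
      vertex′ : Fin d → Fin 3 → Fin n
      vertex′ r s = vertex (proj₁ (σ (r , s))) (proj₂ (σ (r , s)))
      injective : ∀ x y → vertex′ (proj₁ x) (proj₂ x) ≡ vertex′ (proj₁ y) (proj₂ y) → x ≡ y
      injective x y e = let (r≡ , s≡) = disjoint _ _ _ _ e in
        trans (sym (involutive x)) (trans (cong σ (cong₂ _,_ r≡ s≡)) (involutive y))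

    Ws Vs : List (Fin n)
    Ws = mapFilter inW id (allFin n)
    Vs = mapFilter (λ x → not (inW x)) id (allFin n)

    unique-Ws : Unique Ws
    unique-Ws = unique-mapFilter inW id (allFin n) (UniqueP.allFin⁺ n) (λ _ _ _ _ e → e)

    unique-Vs : Unique Vs
    unique-Vs = unique-mapFilter _ id (allFin n) (UniqueP.allFin⁺ n) (λ _ _ _ _ e → e)

    Ws-colour : ∀ {x} → x ∈ Ws → inW x ≡ true
    Ws-colour x∈ with ∈-mapFilter inW id (allFin n) x∈
    ... | _ , _ , inW-x , refl = inW-x

    Vs-colour : ∀ {x} → x ∈ Vs → inW x ≡ false
    Vs-colour x∈ with ∈-mapFilter _ id (allFin n) x∈
    ... | _ , _ , notW-x , refl = not-true notW-x

    |W|+|V| : count inW (allFin n) + length Vs ≡ n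
    |W|+|V| = begin
      count inW (allFin n) + length Vs
        ≡⟨ cong (count inW (allFin n) +_) (length-mapFilter _ id (allFin n)) ⟩
      count inW (allFin n) + count (λ x → not (inW x)) (allFin n)
        ≡⟨ sym (count-split (λ _ → true) inW (allFin n)) ⟩
      count (λ _ → true) (allFin n) ≡⟨ count-const-true (allFin n) ⟩
      length (allFin n)             ≡⟨ length-allFin n ⟩
      n                             ∎
      where open ≡-Reasoning

    initial : countᵇ inW ≡ d → 3 * d ≤ n → Transversal
    initial |W|≡d 3d≤n = record { vertex = vertex ; disjoint = disjoint ; colour = colour }
      where
      d≤|W| : d ≤ length Ws
      d≤|W| = ℕP.≤-reflexive (sym (trans (length-mapFilter inW id (allFin n)) |W|≡d))
      2d≤|V| : 2 * d ≤ length Vs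
      2d≤|V| = ℕP.+-cancelˡ-≤ d _ _ (begin
        d + 2 * d          ≤⟨ 3d≤n ⟩
        n                  ≡⟨ sym |W|+|V| ⟩
        count inW (allFin n) + length Vs ≡⟨ cong (_+ length Vs) |W|≡d ⟩
        d + length Vs      ∎)
        where open ℕP.≤-Reasoning
      w : Fin d → Fin n
      w = entry Ws d≤|W|
      v : Fin (2 * d) → Fin n
      v = entry Vs 2d≤|V|
      vertex : Fin d → Fin 3 → Fin n
      vertex r 0F          = w r
      vertex r (Fin.suc s) = v (Fin.combine s r)
      colour : ∀ r s → inW (vertex r s) ≡ isW s
      colour r 0F          = Ws-colour (∈-lookup _)
      colour r (Fin.suc s) = Vs-colour (∈-lookup _)
      disjoint : ∀ r r' s s' → vertex r s ≡ vertex r' s' → (r ≡ r') × (s ≡ s')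
      disjoint r r' 0F          0F           e = entry-injective Ws d≤|W| unique-Ws r r' e , refl
      disjoint r r' (Fin.suc s) (Fin.suc s') e =
        let (s≡s' , r≡r') = FinP.combine-injective s r s' r' (entry-injective Vs 2d≤|V| unique-Vs _ _ e)
        in r≡r' , cong Fin.suc s≡s'
      disjoint r r' 0F          (Fin.suc s') e with trans (sym (colour r 0F)) (trans (cong inW e) (colour r' (Fin.suc s')))
      ... | ()
      disjoint r r' (Fin.suc s) 0F           e with trans (sym (colour r (Fin.suc s))) (trans (cong inW e) (colour r' 0F))
      ... | ()

    -- rows j, k (distinct from each other and from i) such that switching rows i, j, k
    -- produces three edges of H
    module _ (T : Transversal) where
      open Transversal T

      record Partners (i : Fin d) : Set where
        field
          j k   : Fin d
          j≢i   : j ≢ i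
          k≢i   : k ≢ i
          j≢k   : j ≢ k
          edge₀ : edge H (vertex i 0F) (vertex j 1F) (vertex k 1F) ≡ true
          edge₁ : edge H (vertex i 1F) (vertex j 0F) (vertex k 2F) ≡ true
          edge₂ : edge H (vertex i 2F) (vertex k 0F) (vertex j 2F) ≡ true

    module BadPairs (T : Transversal) (i : Fin d) (i-bad : rowEdge T i ≡ false) where
      open Transversal T

      same-row : ∀ {r r' s s'} → vertex r s ≡ vertex r' s' → r ≡ r'
      same-row e = proj₁ (disjoint _ _ _ _ e)

      apart : ∀ {r r' s s'} → r ≢ r' → vertex r s ≢ vertex r' s'
      apart r≢r' e = r≢r' (same-row e)

      missingTripleᵀ : ∀ {r₁ r₂ r₃ s₁ s₂ s₃} → vertex r₁ s₁ ≢ vertex r₂ s₂ → vertex r₂ s₂ ≢ vertex r₃ s₃ →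
        vertex r₁ s₁ ≢ vertex r₃ s₃ → mixed (isW s₁) (isW s₂) (isW s₃) ≡ true →
        edge H (vertex r₁ s₁) (vertex r₂ s₂) (vertex r₃ s₃) ≡ false →
        MissingTriple (vertex r₁ s₁) (vertex r₂ s₂) (vertex r₃ s₃)
      missingTripleᵀ p q r mix non-edge =
        missingTriple p q r (trans (cong₃ mixed (colour _ _) (colour _ _) (colour _ _)) mix) non-edge

      degenerate : Fin d × Fin d → Bool
      degenerate (j , k) = (j == i) ∨ ((k == i) ∨ (j == k))

      Nondegenerate : Fin d × Fin d → Set
      Nondegenerate (j , k) = j ≢ i × k ≢ i × j ≢ k

      nondegenerate : ∀ a → degenerate a ≡ false → Nondegenerate a
      nondegenerate (j , k) ok =
        let (j≠i , rest) = ∨-false {j == i} ok ; (k≠i , j≠k) = ∨-false {k == i} rest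
        in ==-false j i j≠i , ==-false k i k≠i , ==-false j k j≠k

      -- the triples which would become rows i, j, k after the switch
      switched₀ switched₁ switched₂ : Fin d × Fin d → Bool
      switched₀ (j , k) = edge H (vertex i 0F) (vertex j 1F) (vertex k 1F)
      switched₁ (j , k) = edge H (vertex i 1F) (vertex j 0F) (vertex k 2F)
      switched₂ (j , k) = edge H (vertex i 2F) (vertex k 0F) (vertex j 2F)

      failing : (Fin d × Fin d → Bool) → Fin d × Fin d → Bool
      failing switched a = not (degenerate a) ∧ not (switched a)

      failing-sound : ∀ switched a → failing switched a ≡ true → Nondegenerate a × switched a ≡ false
      failing-sound switched a fails =
        let (nondeg , non-edge) = ∧-true fails in nondegenerate a (not-true nondeg) , not-true non-edge

      bad : Fin d × Fin d → Bool
      bad a = degenerate a ∨ (failing switched₀ a ∨ (failing switched₁ a ∨ failing switched₂ a))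

      -- each of j = i, k = i, j = k leaves one coordinate free
      count-degenerate : count degenerate (pairs d) ≤ d + (d + d)
      count-degenerate =
        ℕP.≤-trans (count-∨ (λ a → proj₁ a == i) _ (pairs d)) (ℕP.+-mono-≤ j≡i
          (ℕP.≤-trans (count-∨ (λ a → proj₂ a == i) _ (pairs d)) (ℕP.+-mono-≤ k≡i j≡k)))
        where
        j≡i : count (λ a → proj₁ a == i) (pairs d) ≤ d
        j≡i = count≤size _ proj₂ (pairs d) (unique-pairs d)
          λ { (j , k) (j' , k') e e' refl → cong (_, k) (trans (==-sound j i e) (sym (==-sound j' i e'))) }
        k≡i : count (λ a → proj₂ a == i) (pairs d) ≤ d
        k≡i = count≤size _ proj₁ (pairs d) (unique-pairs d)
          λ { (j , k) (j' , k') e e' refl → cong (j ,_) (trans (==-sound k i e) (sym (==-sound k' i e'))) }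
        j≡k : count (λ a → proj₁ a == proj₂ a) (pairs d) ≤ d
        j≡k = count≤size _ proj₁ (pairs d) (unique-pairs d)
          λ { (j , k) (j' , k') e e' refl → cong (j ,_) (trans (sym (==-sound j k e)) (==-sound j k' e')) }

      m₀ m₁ m₂ : ℕ
      m₀ = missing inW H (vertex i 0F)
      m₁ = missing inW H (vertex i 1F)
      m₂ = missing inW H (vertex i 2F)

      -- a failing pair (j , k) gives a missing triple at the s-th vertex of row i, formed with
      -- the two vertices the switch brings in from rows j and k; distinct pairs bring in
      -- distinct vertex pairs
      count-failing₀ : count (failing switched₀) (pairs d) ≤ m₀ + m₀
      count-failing₀ = count≤twice-missing (vertex i 0F) (failing switched₀)
        (λ { (j , k) → vertex j 1F , vertex k 1F }) (pairs d) (unique-pairs d)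
        (λ { (j , k) (j' , k') _ _ e → cong₂ _,_ (same-row (cong proj₁ e)) (same-row (cong proj₂ e)) })
        λ { (j , k) fails → let ((j≢i , k≢i , j≢k) , non-edge) = failing-sound switched₀ (j , k) fails in
            missingTripleᵀ (apart (≢-sym j≢i)) (apart j≢k) (apart (≢-sym k≢i)) refl non-edge }

      count-failing₁ : count (failing switched₁) (pairs d) ≤ m₁ + m₁
      count-failing₁ = count≤twice-missing (vertex i 1F) (failing switched₁)
        (λ { (j , k) → vertex j 0F , vertex k 2F }) (pairs d) (unique-pairs d)
        (λ { (j , k) (j' , k') _ _ e → cong₂ _,_ (same-row (cong proj₁ e)) (same-row (cong proj₂ e)) })
        λ { (j , k) fails → let ((j≢i , k≢i , j≢k) , non-edge) = failing-sound switched₁ (j , k) fails in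
            missingTripleᵀ (apart (≢-sym j≢i)) (apart j≢k) (apart (≢-sym k≢i)) refl non-edge }

      count-failing₂ : count (failing switched₂) (pairs d) ≤ m₂ + m₂
      count-failing₂ = count≤twice-missing (vertex i 2F) (failing switched₂)
        (λ { (j , k) → vertex k 0F , vertex j 2F }) (pairs d) (unique-pairs d)
        (λ { (j , k) (j' , k') _ _ e → cong₂ _,_ (same-row (cong proj₂ e)) (same-row (cong proj₁ e)) })
        λ { (j , k) fails → let ((j≢i , k≢i , j≢k) , non-edge) = failing-sound switched₂ (j , k) fails in
            missingTripleᵀ (apart (≢-sym k≢i)) (apart (≢-sym j≢k)) (apart (≢-sym j≢i)) refl non-edge }

      count-bad : count bad (pairs d) ≤ d + (d + d) + ((m₀ + m₀) + ((m₁ + m₁) + (m₂ + m₂)))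
      count-bad =
        ℕP.≤-trans (count-∨ degenerate _ (pairs d)) (ℕP.+-mono-≤ count-degenerate
          (ℕP.≤-trans (count-∨ (failing switched₀) _ (pairs d)) (ℕP.+-mono-≤ count-failing₀
            (ℕP.≤-trans (count-∨ (failing switched₁) _ (pairs d)) (ℕP.+-mono-≤ count-failing₁ count-failing₂)))))

      -- row i itself is a missing triple at its W-vertex, so m₀ ≥ 1
      1≤m₀ : 1 ≤ m₀
      1≤m₀ = missing-pos (missingTripleᵀ (apart-slots (λ ())) (apart-slots (λ ())) (apart-slots (λ ())) refl i-bad)
        where
        apart-slots : ∀ {s s'} → s ≢ s' → vertex i s ≢ vertex i s'
        apart-slots s≢s' e = s≢s' (proj₂ (disjoint _ _ _ _ e))

      partners : n ≤ 150 * d → (∀ v → missing inW H v * 1000000 ≤ n * n) → Partners T i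
      partners n≤150d sparse = from-good-pair (count<length⇒witness bad (pairs d) fewer)
        where
        fewer : count bad (pairs d) < length (pairs d)
        fewer = ℕP.≤-<-trans count-bad
          (subst (d + (d + d) + ((m₀ + m₀) + ((m₁ + m₁) + (m₂ + m₂))) <_) (sym (length-pairs d))
          (fewer-than-d² n d m₀ m₁ m₂ n≤150d (sparse _) (sparse _) (sparse _) 1≤m₀))
        passes : ∀ {δ e} → δ ≡ false → (not δ ∧ not e) ≡ false → e ≡ true
        passes refl fails = not-false fails
        from-good-pair : Σ (Fin d × Fin d) (λ a → a ∈ pairs d × bad a ≡ false) → Partners T i
        from-good-pair ((j , k) , _ , good) =
          let (nondeg , rest) = ∨-false {degenerate (j , k)} good
              (ok₀ , rest′)   = ∨-false {failing switched₀ (j , k)} rest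
              (ok₁ , ok₂)     = ∨-false {failing switched₁ (j , k)} rest′
              (j≢i , k≢i , j≢k) = nondegenerate (j , k) nondeg
          in record { j = j ; k = k ; j≢i = j≢i ; k≢i = k≢i ; j≢k = j≢k
                    ; edge₀ = passes nondeg ok₀ ; edge₁ = passes nondeg ok₁ ; edge₂ = passes nondeg ok₂ }

    -- (role, slot) after the switch ↦ (role, slot) whose vertex it receives
    exchange : Fin 3 × Fin 3 → Fin 3 × Fin 3
    exchange (ρ  , 0F) = ρ , 0F
    exchange (0F , 1F) = 1F , 1F
    exchange (0F , 2F) = 2F , 1F
    exchange (1F , 1F) = 0F , 1F
    exchange (1F , 2F) = 2F , 2F
    exchange (2F , 1F) = 0F , 2F
    exchange (2F , 2F) = 1F , 2F

    exchange-involutive : ∀ x → exchange (exchange x) ≡ x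
    exchange-involutive (ρ  , 0F) = refl
    exchange-involutive (0F , 1F) = refl
    exchange-involutive (0F , 2F) = refl
    exchange-involutive (1F , 1F) = refl
    exchange-involutive (1F , 2F) = refl
    exchange-involutive (2F , 1F) = refl
    exchange-involutive (2F , 2F) = refl

    exchange-colour : ∀ x → isW (proj₂ (exchange x)) ≡ isW (proj₂ x)
    exchange-colour (ρ  , 0F) = refl
    exchange-colour (0F , 1F) = refl
    exchange-colour (0F , 2F) = refl
    exchange-colour (1F , 1F) = refl
    exchange-colour (1F , 2F) = refl
    exchange-colour (2F , 1F) = refl
    exchange-colour (2F , 2F) = refl

    module Switch (T : Transversal) (i j k : Fin d) (j≢i : j ≢ i) (k≢i : k ≢ i) (j≢k : j ≢ k) where
      open Transversal T

      row : Fin 3 → Fin d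
      row 0F = i
      row 1F = j
      row 2F = k

      role : Fin d → Maybe (Fin 3)
      role r = if r == i then just 0F else if r == j then just 1F else if r == k then just 2F else nothing

      role-row : ∀ ρ → role (row ρ) ≡ just ρ
      role-row 0F rewrite dec-true (i ≟ i) refl = refl
      role-row 1F rewrite dec-false (j ≟ i) j≢i | dec-true (j ≟ j) refl = refl
      role-row 2F rewrite dec-false (k ≟ i) k≢i | dec-false (k ≟ j) (≢-sym j≢k) | dec-true (k ≟ k) refl = refl

      row-role : ∀ r ρ → role r ≡ just ρ → row ρ ≡ r
      row-role r ρ e with r == i in r≟i | r == j in r≟j | r == k in r≟k
      row-role r 0F refl | true  | _     | _    = sym (==-sound r i r≟i)
      row-role r 1F refl | false | true  | _    = sym (==-sound r j r≟j)
      row-role r 2F refl | false | false | true = sym (==-sound r k r≟k)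

      move : Maybe (Fin 3) → Fin d × Fin 3 → Fin d × Fin 3
      move nothing  x       = x
      move (just ρ) (_ , s) = row (proj₁ (exchange (ρ , s))) , proj₂ (exchange (ρ , s))

      σ : Fin d × Fin 3 → Fin d × Fin 3
      σ (r , s) = move (role r) (r , s)

      σ-involutive : ∀ x → σ (σ x) ≡ x
      σ-involutive (r , s) with role r in role-r
      ... | nothing rewrite role-r = refl
      ... | just ρ rewrite role-row (proj₁ (exchange (ρ , s))) | exchange-involutive (ρ , s) =
        cong (_, s) (row-role r ρ role-r)

      σ-colour : ∀ x → isW (proj₂ (σ x)) ≡ isW (proj₂ x)
      σ-colour (r , s) with role r
      ... | nothing = refl
      ... | just ρ  = exchange-colour (ρ , s)

      switched : Transversal
      switched = reslot T σ σ-involutive σ-colour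

      switched-row : ∀ ρ s → Transversal.vertex switched (row ρ) s ≡
        vertex (row (proj₁ (exchange (ρ , s)))) (proj₂ (exchange (ρ , s)))
      switched-row ρ s rewrite role-row ρ = refl

      switched-other : ∀ r s → role r ≡ nothing → Transversal.vertex switched r s ≡ vertex r s
      switched-other r s uninvolved rewrite uninvolved = refl

    repair : (T : Transversal) (i : Fin d) → Partners T i →
      Σ Transversal λ T′ → rowEdge T′ i ≡ true × (∀ r → rowEdge T r ≡ true → rowEdge T′ r ≡ true)
    repair T i p = S.switched , new-row 0F , kept
      where
      open Partners p
      open Transversal T
      module S = Switch T i j k j≢i k≢i j≢k
      rowEdge-switched : ∀ ρ → rowEdge S.switched (S.row ρ) ≡
        edge H (vertex (S.row (proj₁ (exchange (ρ , 0F)))) (proj₂ (exchange (ρ , 0F))))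
               (vertex (S.row (proj₁ (exchange (ρ , 1F)))) (proj₂ (exchange (ρ , 1F))))
               (vertex (S.row (proj₁ (exchange (ρ , 2F)))) (proj₂ (exchange (ρ , 2F))))
      rowEdge-switched ρ = cong₃ (edge H) (S.switched-row ρ 0F) (S.switched-row ρ 1F) (S.switched-row ρ 2F)
      new-row : ∀ ρ → rowEdge S.switched (S.row ρ) ≡ true
      new-row 0F = trans (rowEdge-switched 0F) edge₀
      new-row 1F = trans (rowEdge-switched 1F) (trans (H .sym₁₂ _ _ _) edge₁)
      new-row 2F = trans (rowEdge-switched 2F) (trans (H .sym₁₂ _ _ _) edge₂)
      kept : ∀ r → rowEdge T r ≡ true → rowEdge S.switched r ≡ true
      kept r old = by-role (S.role r) refl
        where
        by-role : ∀ m → S.role r ≡ m → rowEdge S.switched r ≡ true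
        by-role nothing  uninvolved = trans (cong₃ (edge H) (S.switched-other r 0F uninvolved)
          (S.switched-other r 1F uninvolved) (S.switched-other r 2F uninvolved)) old
        by-role (just ρ) role-r = subst (λ r′ → rowEdge S.switched r′ ≡ true) (S.row-role r ρ role-r) (new-row ρ)

    module Repairing (n≤150d : n ≤ 150 * d) (sparse : ∀ v → missing inW H v * 1000000 ≤ n * n) where

      fix-row : (T : Transversal) (i : Fin d) →
        Σ Transversal λ T′ → rowEdge T′ i ≡ true × (∀ r → rowEdge T r ≡ true → rowEdge T′ r ≡ true)
      fix-row T i with rowEdge T i in i-edge
      ... | true  = T , i-edge , λ _ e → e
      ... | false = repair T i (BadPairs.partners T i i-edge n≤150d sparse)

      FirstRows : Transversal → ℕ → Set
      FirstRows T t = ∀ r → toℕ r < t → rowEdge T r ≡ true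

      first-rows : Transversal → ∀ t → t ≤ d → Σ Transversal λ T → FirstRows T t
      first-rows T₀ zero    _   = T₀ , λ _ ()
      first-rows T₀ (suc t) t<d with first-rows T₀ t (ℕP.<⇒≤ t<d)
      ... | T , first-t with fix-row T (Fin.fromℕ< t<d)
      ...   | T′ , t-edge , kept = T′ , first-suc-t
        where
        first-suc-t : FirstRows T′ (suc t)
        first-suc-t r r<1+t with ℕP.m≤n⇒m<n∨m≡n (ℕP.≤-pred r<1+t)
        ... | inj₁ r<t = kept r (first-t r r<t)
        ... | inj₂ r≡t = subst (λ r′ → rowEdge T′ r′ ≡ true)
                           (FinP.toℕ-injective (trans (FinP.toℕ-fromℕ< t<d) (sym r≡t))) t-edge

      matching : Transversal → Matching H d
      matching T₀ = record { M = vertex ; isEdge = λ r → all-rows r (FinP.toℕ<n r) ; disjoint = disjoint }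
        where
        T-all : Σ Transversal λ T → FirstRows T d
        T-all = first-rows T₀ d ℕP.≤-refl
        open Transversal (proj₁ T-all)
        all-rows : FirstRows (proj₁ T-all) d
        all-rows = proj₂ T-all

open import Defs
open import Data.Nat using (ℕ; _≤_; _*_)
open import Data.Bool using (Bool)
open import Data.Fin using (Fin)
open import Relation.Binary.PropositionalEquality using (_≡_)
open import Data.Integer using (+_)
open import Data.Rational using (ℚ; _/_; _<_; 0ℚ)
open SwitchingArgument using (scaled-bound; module Switching)

lemma4p2 : (α : ℚ) → 0ℚ < α → α < (+ 1) / 1000000 →
    (n d : ℕ) → n ≤ 150 * d → 3 * d ≤ n →
    (inW : Fin n → Bool) → countᵇ inW ≡ d →
    (H : Hypergraph3 n) → (∀ v → good α inW H v) →
    Matching H d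
lemma4p2 α 0<α α<10⁻⁶ n d n≤150d 3d≤n inW |W|≡d H all-good =
  Repairing.matching n≤150d sparse (initial |W|≡d 3d≤n)
  where
  open Switching n d inW H
  sparse : ∀ v → missing inW H v * 1000000 ≤ n * n
  sparse v = scaled-bound 999999 α 0<α α<10⁻⁶ (missing inW H v) (n * n) (all-good v)
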